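{- Let $\Upsilon=\Upsilon(\underline{\psi},\underline{\delta})$ and $\widehat\Upsilon=\widehat\Upsilon(\underline{\widehat\psi},\underline{\widehat\delta})$ be triangular $\mathbf{t}$-modules over $K$. If $\operatorname{rk}\psi_l\neq\operatorname{rk}\widehat\psi_j$ for all $l,j$, then $\operatorname{Hom}_\tau(\Upsilon,\widehat\Upsilon)=\operatorname{Hom}_\tau(\widehat\Upsilon,\Upsilon)=0$.
   Context: Let $A=\mathbb F_q[t]$, $K$ an $A$-field with $\theta$ the image of $t$, $K\{\tau\}$ the twisted polynomial ring ($\tau c=c^q\tau$). A $\mathbf{t}$-module of dimension $d$ is an $\mathbb F_q$-algebra homomorphism $\Phi:A\to\mathrm{Mat}_d(K\{\tau\})$ with constant term of $\Phi_t$ equal to $\theta I_d+N$, $N$ nilpotent. A Drinfeld module is a $\mathbf{t}$-module $\psi$ of dimension $1$ with $\psi_t=\theta+a_1\tau+\dots+a_r\tau^r$, $a_r\ne0$, $r\ge1$; $\operatorname{rk}\psi=r$. $\operatorname{Hom}_\tau(\Phi,\Psi)$ is the set of $F\in\mathrm{Mat}_{e\times d}(K\{\tau\})$ with $F\Phi_t=\Psi_tF$ ($d=\dim\Phi$, $e=\dim\Psi$). Triangular $\mathbf{t}$-module $\Upsilon(\underline\psi,\underline\delta)$ of dimension $n$: with rows and columns indexed $n,\dots,1$ from top to bottom and left to right, $\Upsilon_t$ is lower triangular with diagonal entry $\psi_{k,t}$ at $(k,k)$ for Drinfeld modules $\psi_1,\dots,\psi_n$, entry $\delta_{i\times j}\in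 K\{\tau\}$ in row $i$, column $j$ for $i<j$, zeros elsewhere. -}

module Defs where

open import Level using (Level; _⊔_)
open import Algebra.Bundles using (CommutativeRing)
open import Data.Nat as ℕ using (ℕ; zero; suc; _≤_; _<_)
open import Data.Nat.Primality using (Prime)
open import Data.Fin as Fin using (Fin)
open import Data.Product using (Σ; ∃; _×_; _,_; proj₁; proj₂)
open import Relation.Nullary using (¬_)
open import Function.Definitions using (Injective)
open import Relation.Binary.PropositionalEquality using (_≡_)
open import Relation.Nullary using (yes; no)

record IsFieldCR {c ℓ} (R : CommutativeRing c ℓ) : Set (c ⊔ ℓ) where
  open CommutativeRing R using (Carrier; _≈_; _*_; _+_; 0#; 1#)
  field
    1≉0     : ¬ (1# ≈ 0#)
    inverse : ∀ x → ¬ (x ≈ 0#) → ∃ λ y → (x * y) ≈ 1#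

module _ {c ℓ} (R : CommutativeRing c ℓ) where
  open CommutativeRing R using (Carrier; _≈_; _*_; _+_; 0#; 1#)
  pow : Carrier → ℕ → Carrier
  pow x zero    = 1#
  pow x (suc n) = x * pow x n

  natMul : ℕ → Carrier
  natMul zero    = 0#
  natMul (suc n) = 1# + natMul n

-- A-fields, A = F_q[t]: a field K of characteristic p containing F_q
-- (q = p^e, e ≥ 1), together with θ ∈ K, the image of t.
-- F_q ⊆ K is expressed as: X^q - X has q distinct roots in K
-- (these roots form the unique copy of F_q inside K).

record AField (c ℓ : Level) : Set (Level.suc (c ⊔ ℓ)) where
  field
    R       : CommutativeRing c ℓ
    isField : IsFieldCR R
  open CommutativeRing R public
  field
    p     : ℕ
    prime : Prime p
    e     : ℕ
    e≥1   : 1 ≤ e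
    char  : natMul R p ≈ 0#
  q : ℕ
  q = p ℕ.^ e
  field
    ι     : Fin q → Carrier
    ι-inj : ∀ {a b} → ι a ≈ ι b → a ≡ b
    ι-Fq  : ∀ a → pow R (ι a) q ≈ ι a
    θ     : Carrier

-- The twisted polynomial ring K{τ}, τ c = c^q τ.
-- An element is its coefficient sequence (coefficient of τ^n) with
-- finite support.

module _ {c ℓ} (K : AField c ℓ) where
  open AField K using (R; Carrier; _≈_; _+_; _*_; 0#; 1#; refl; q; θ)

  Seq : Set c
  Seq = ℕ → Carrier

  record Tw : Set (c ⊔ ℓ) where
    constructor mkTw
    field
      coeff   : Seq
      bound   : ℕ
      support : ∀ n → bound ≤ n → coeff n ≈ 0#
  open Tw public

  frob : ℕ → Carrier → Carrier
  frob i x = pow R x (q ℕ.^ i)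

  -- Σ_{i+j=n} f_i g_j^{q^i}
  convAux : Seq → Seq → ℕ → ℕ → Carrier
  -- convAux f g i m : Σ_{k ≤ m} f_{i+k} (g_{m-k})^{q^{i+k}}
  convAux f g i zero    = f i * frob i (g zero)
  convAux f g i (suc m) = (f i * frob i (g (suc m))) + convAux f g (suc i) m

  mulSeq : Seq → Seq → Seq
  mulSeq f g n = convAux f g 0 n

  addSeq : Seq → Seq → Seq
  addSeq f g n = f n + g n

  zeroSeq : Seq
  zeroSeq _ = 0#

  _≈τ_ : Tw → Tw → Set ℓ
  f ≈τ g = ∀ n → coeff f n ≈ coeff g n

  zeroTw : Tw
  zeroTw = mkTw zeroSeq 0 (λ _ _ → refl)

  Mat : ℕ → ℕ → Set (c ⊔ ℓ)
  Mat m n = Fin m → Fin n → Tw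

  sumFin : (n : ℕ) → (Fin n → Seq) → Seq
  sumFin zero    f = zeroSeq
  sumFin (suc n) f = addSeq (f Fin.zero) (sumFin n (λ k → f (Fin.suc k)))

  matMul : ∀ {m k n} → Mat m k → Mat k n → Fin m → Fin n → Seq
  matMul {k = k} F G i j = sumFin k (λ l → mulSeq (coeff (F i l)) (coeff (G l j)))

  record Drinfeld : Set (c ⊔ ℓ) where
    field
      rank   : ℕ
      rank≥1 : 1 ≤ rank
      ψt     : Tw
      const  : coeff ψt 0 ≈ θ
      lead   : ¬ (coeff ψt rank ≈ 0#)
      above  : ∀ m → rank < m → coeff ψt m ≈ 0#
  open Drinfeld public

  -- Rows/columns are labelled by Fin n (label k stands for k+1 of the
  -- paper).  Entry in row i, column j is ψ_i,t if i = j, δ_{i×j} if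
  -- i < j and 0 if i > j.  (δ i j is only used for i < j.)

  record Triangular (n : ℕ) : Set (c ⊔ ℓ) where
    field
      ψ : Fin n → Drinfeld
      δ : Fin n → Fin n → Tw
  open Triangular public

  Υt : ∀ {n} → Triangular n → Mat n n
  Υt T i j with i Fin.≟ j
  ... | yes _ = ψt (ψ T i)
  ... | no _ with i Fin.<? j
  ...   | yes _ = δ T i j
  ...   | no _  = zeroTw

  IsHom : ∀ {d e} → Mat d d → Mat e e → Mat e d → Set ℓ
  IsHom Φt Ψt F = ∀ i j n → matMul F Φt i j n ≈ matMul Ψt F i j n

  HomZero : ∀ {d e} → Mat d d → Mat e e → Set (c ⊔ ℓ)
  HomZero {d} {e} Φt Ψt = (F : Mat e d) → IsHom Φt Ψt F → ∀ i j → F i j ≈τ zeroTw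

-- Let f φ = ψ f with φ, ψ Drinfeld modules of ranks r ≠ s. Comparing the top coefficients
-- of the two sides shows that the top coefficient of f is zero; since equality in K is not
-- decidable, this only proves that every coefficient of f is ¬¬-zero. The coefficient of
-- τ^(m+r) in f φ = ψ f expresses f_m a_r^(q^m) through higher coefficients of f and their
-- q^i-th powers (i ≥ 1), so all coefficients lie in the ideal generated by their own
-- squares, and finitely many ¬¬-zero elements of a field with this property are zero. For triangular t-modules,
-- an entry F i j of a morphism whose neighbours to the left and below vanish satisfies
-- F i j ψ_j = ψ̂_i F i j, so all entries vanish by induction.

module Submission where

open import Level using (_⊔_)
open import Algebra.Bundles using (CommutativeRing; Ring)
open import Data.Nat as ℕ using (ℕ; zero; suc)
open import Data.Fin using (Fin; zero; suc; toℕ; fromℕ<)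
open import Data.Fin.Properties using (toℕ-fromℕ<)
open import Data.Product using (∃; _×_; _,_; proj₁; proj₂)
open import Data.Sum using (_⊎_; inj₁; inj₂)
open import Data.Empty using (⊥-elim)
open import Relation.Binary.PropositionalEquality as ≡ using (_≡_; _≢_)
open import Relation.Binary.Definitions using (tri<; tri≈; tri>)
open import Relation.Nullary using (¬_; yes; no)
open import Data.Vec.Functional using (Vector; head; tail)
open import Function using (_∘_; case_of_)
open import Defs

module _ where
  open import Data.Nat using (_+_; _<_; _≤_; _<?_)
  open import Data.Nat.Properties
    using (<-cmp; +-cancelˡ-<; <-≤-trans; +-monoˡ-≤; +-monoˡ-<; ≮⇒≥; ≤-<-trans; m≤m+n; m≤n⇒m<n∨m≡n)

  +-<-split : ∀ {m d i j} → m + d < i + j → m < i ⊎ d < j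
  +-<-split {m} {d} {i} {j} m+d<i+j with m <? i
  ... | yes m<i = inj₁ m<i
  ... | no  m≮i = inj₂ (+-cancelˡ-< m d j (<-≤-trans m+d<i+j (+-monoˡ-≤ j (≮⇒≥ m≮i))))

  +-≡-split : ∀ {m d i j} → i + j ≡ m + d → i ≢ m → m < i ⊎ d < j
  +-≡-split {m} {d} {i} {j} i+j≡m+d i≢m with <-cmp m i
  ... | tri< m<i _ _ = inj₁ m<i
  ... | tri≈ _ m≡i _ = ⊥-elim (i≢m (≡.sym m≡i))
  ... | tri> _ _ i<m = inj₂ (+-cancelˡ-< m d j (≡.subst (_< m + j) i+j≡m+d (+-monoˡ-< j i<m)))

  downwardInduction : ∀ {p} (P : ℕ → Set p) b → (∀ k → b < k → P k) →
                      (∀ m → (∀ k → m < k → P k) → P m) → ∀ n → P n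
  downwardInduction P b P-above step n =
    step n (lift b λ k b+n<k → P-above k (≤-<-trans (m≤m+n b n) b+n<k))
    where
    Above : ℕ → Set _
    Above m = ∀ k → m < k → P k

    lower : ∀ {m} → Above (suc m) → Above m
    lower {m} P↑ k m<k with m≤n⇒m<n∨m≡n m<k
    ... | inj₁ 1+m<k   = P↑ k 1+m<k
    ... | inj₂ ≡.refl = step (suc m) P↑

    lift : ∀ t {m} → Above (t + m) → Above m
    lift zero    P↑ = P↑
    lift (suc t) P↑ = lift t (lower P↑)

module FieldProperties {c ℓ} (R : CommutativeRing c ℓ) (isField : IsFieldCR R) where
  open CommutativeRing R hiding (zero)
  open IsFieldCR isField
  open import Algebra.Properties.Semiring.Sum semiring
    using (sum; sum-cong-≋; sum-replicate-zero; ∑-distrib-+; *-distribˡ-sum)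
  open import Algebra.Properties.Group +-group using (//-rightDividesʳ; ε⁻¹≈ε)
  open import Algebra.Properties.AbelianGroup +-abelianGroup using (xyx⁻¹≈y)
  open import Algebra.Properties.Ring ring using (-1*x≈-x)
  open import Algebra.Properties.RingWithoutOne (Ring.ringWithoutOne ring) using ([y-z]x≈yx-zx)
  open import Relation.Binary.Reasoning.Setoid setoid

  ≉0⇒invertibleʳ : ∀ {u} → ¬ u ≈ 0# → ∃ λ w → ∀ x → x * u * w ≈ x
  ≉0⇒invertibleʳ {u} u≉0 with inverse u u≉0
  ... | w , u*w≈1 = w , λ x → begin
    x * u * w   ≈⟨ *-assoc x u w ⟩
    x * (u * w) ≈⟨ *-congˡ u*w≈1 ⟩
    x * 1#      ≈⟨ *-identityʳ x ⟩
    x           ∎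

  *-≉0 : ∀ {x y} → ¬ x ≈ 0# → ¬ y ≈ 0# → ¬ x * y ≈ 0#
  *-≉0 {x} {y} x≉0 y≉0 x*y≈0 with ≉0⇒invertibleʳ y≉0
  ... | w , cancel = x≉0 (begin
    x         ≈⟨ cancel x ⟨
    x * y * w ≈⟨ *-congʳ x*y≈0 ⟩
    0# * w    ≈⟨ zeroˡ w ⟩
    0#        ∎)

  pow-congˡ : ∀ {x y} n → x ≈ y → pow R x n ≈ pow R y n
  pow-congˡ zero    x≈y = refl
  pow-congˡ (suc n) x≈y = *-cong x≈y (pow-congˡ n x≈y)

  pow-zero : ∀ {n} → 0 ℕ.< n → pow R 0# n ≈ 0#
  pow-zero {suc n} _ = zeroˡ (pow R 0# n)

  pow-≉0 : ∀ {x} n → ¬ x ≈ 0# → ¬ pow R x n ≈ 0#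
  pow-≉0 zero    x≉0 = 1≉0
  pow-≉0 (suc n) x≉0 = *-≉0 x≉0 (pow-≉0 n x≉0)

  sum-zeroˡ : ∀ {B} (h : Vector Carrier B) → sum (λ j → 0# * h j) ≈ 0#
  sum-zeroˡ {B} h = trans (sum-cong-≋ {B} (λ j → zeroˡ (h j))) (sum-replicate-zero B)

  infix 4 _∈⟨_⟩
  _∈⟨_⟩ : ∀ {B} → Carrier → Vector Carrier B → Set (c ⊔ ℓ)
  _∈⟨_⟩ {B} x g = ∃ λ (a : Vector Carrier B) → x ≈ sum (λ j → a j * g j)

  module _ {B} {g : Vector Carrier B} where

    ∈⟨⟩-resp : ∀ {x y} → x ≈ y → x ∈⟨ g ⟩ → y ∈⟨ g ⟩
    ∈⟨⟩-resp x≈y (a , x≈∑) = a , trans (sym x≈y) x≈∑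

    ∈⟨⟩-null : (∀ j → g j ≈ 0#) → ∀ {x} → x ∈⟨ g ⟩ → x ≈ 0#
    ∈⟨⟩-null g≈0 (a , x≈∑) = trans x≈∑ (trans
      (sum-cong-≋ {B} (λ j → trans (*-congˡ (g≈0 j)) (zeroʳ (a j))))
      (sum-replicate-zero B))

    ≈0⇒∈⟨⟩ : ∀ {x} → x ≈ 0# → x ∈⟨ g ⟩
    ≈0⇒∈⟨⟩ x≈0 = (λ _ → 0#) , (begin
      _                       ≈⟨ x≈0 ⟩
      0#                      ≈⟨ sum-zeroˡ g ⟨
      sum (λ j → 0# * g j)    ∎)

    ∈⟨⟩-+ : ∀ {x y} → x ∈⟨ g ⟩ → y ∈⟨ g ⟩ → x + y ∈⟨ g ⟩
    ∈⟨⟩-+ (a , x≈∑) (b , y≈∑) = (λ j → a j + b j) , (begin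
      _ + _                                           ≈⟨ +-cong x≈∑ y≈∑ ⟩
      sum (λ j → a j * g j) + sum (λ j → b j * g j)   ≈⟨ ∑-distrib-+ (λ j → a j * g j) (λ j → b j * g j) ⟨
      sum (λ j → a j * g j + b j * g j)               ≈⟨ sum-cong-≋ (λ j → distribʳ (g j) (a j) (b j)) ⟨
      sum (λ j → (a j + b j) * g j)                   ∎)

    ∈⟨⟩-*ˡ : ∀ k {x} → x ∈⟨ g ⟩ → k * x ∈⟨ g ⟩
    ∈⟨⟩-*ˡ k (a , x≈∑) = (λ j → k * a j) , (begin
      k * _                          ≈⟨ *-congˡ x≈∑ ⟩
      k * sum (λ j → a j * g j)      ≈⟨ *-distribˡ-sum k (λ j → a j * g j) ⟩
      sum (λ j → k * (a j * g j))    ≈⟨ sum-cong-≋ (λ j → *-assoc k (a j) (g j)) ⟨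
      sum (λ j → k * a j * g j)      ∎)

    ∈⟨⟩-*ʳ : ∀ k {x} → x ∈⟨ g ⟩ → x * k ∈⟨ g ⟩
    ∈⟨⟩-*ʳ k x∈ = ∈⟨⟩-resp (*-comm k _) (∈⟨⟩-*ˡ k x∈)

    ∈⟨⟩-cancelʳ : ∀ {x y} → x + y ∈⟨ g ⟩ → y ∈⟨ g ⟩ → x ∈⟨ g ⟩
    ∈⟨⟩-cancelʳ {x} {y} x+y∈ y∈ = ∈⟨⟩-resp x+y-y≈x (∈⟨⟩-+ x+y∈ (∈⟨⟩-*ˡ (- 1#) y∈))
      where
      x+y-y≈x : x + y + - 1# * y ≈ x
      x+y-y≈x = trans (+-congˡ (-1*x≈-x y)) (//-rightDividesʳ y x)

    ∈⟨⟩-cancel-≉0 : ∀ {x u} → ¬ u ≈ 0# → x * u ∈⟨ g ⟩ → x ∈⟨ g ⟩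
    ∈⟨⟩-cancel-≉0 {x} u≉0 x*u∈ with ≉0⇒invertibleʳ u≉0
    ... | w , cancel = ∈⟨⟩-resp (cancel x) (∈⟨⟩-*ʳ w x*u∈)

  module _ {B} {g : Vector Carrier (suc B)} where

    ∈⟨tail⟩⇒∈⟨⟩ : ∀ {x} → x ∈⟨ tail g ⟩ → x ∈⟨ g ⟩
    ∈⟨tail⟩⇒∈⟨⟩ (a , x≈∑) = (λ { zero → 0# ; (suc j) → a j }) ,
      trans x≈∑ (sym (trans (+-congʳ (zeroˡ (head g))) (+-identityˡ _)))

    head∈⟨⟩ : head g ∈⟨ g ⟩
    head∈⟨⟩ = (λ { zero → 1# ; (suc j) → 0# }) , sym (begin
      1# * head g + sum (λ j → 0# * tail g j) ≈⟨ +-cong (*-identityˡ (head g)) (sum-zeroˡ (tail g)) ⟩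
      head g + 0#                             ≈⟨ +-identityʳ (head g) ⟩
      head g                                  ∎)

    ∈⟨⟩-eliminate-head : head g ∈⟨ tail g ⟩ → ∀ {x} → x ∈⟨ g ⟩ → x ∈⟨ tail g ⟩
    ∈⟨⟩-eliminate-head g₀∈ (a , x≈∑) =
      ∈⟨⟩-resp (sym x≈∑) (∈⟨⟩-+ (∈⟨⟩-*ˡ (a zero) g₀∈) (tail a , refl))

  generator∈⟨⟩ : ∀ {B} {g : Vector Carrier B} j → g j ∈⟨ g ⟩
  generator∈⟨⟩ {g = g} zero    = head∈⟨⟩ {g = g}
  generator∈⟨⟩ {g = g} (suc j) = ∈⟨tail⟩⇒∈⟨⟩ {g = g} (generator∈⟨⟩ j)

  pow∈⟨⟩ : ∀ {B} {g : Vector Carrier B} {x N} → 2 ℕ.≤ N → x * x ∈⟨ g ⟩ → pow R x N ∈⟨ g ⟩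
  pow∈⟨⟩ {x = x} {suc (suc N)} (ℕ.s≤s (ℕ.s≤s _)) x²∈ =
    ∈⟨⟩-resp (*-assoc x x (pow R x N)) (∈⟨⟩-*ʳ (pow R x N) x²∈)

  record IsAdditivelyClosed {p} (Q : Carrier → Set p) : Set (c ⊔ ℓ ⊔ p) where
    field
      resp      : ∀ {x y} → x ≈ y → Q x → Q y
      +-closed  : ∀ {x y} → Q x → Q y → Q (x + y)
      +-cancelʳ : ∀ {x y} → Q (x + y) → Q y → Q x

    +-cancelˡ : ∀ {x y} → Q (x + y) → Q x → Q y
    +-cancelˡ Qx+y Qx = +-cancelʳ (resp (+-comm _ _) Qx+y) Qx

  ≈0-isAdditivelyClosed : IsAdditivelyClosed (_≈ 0#)
  ≈0-isAdditivelyClosed = record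
    { resp      = λ x≈y x≈0 → trans (sym x≈y) x≈0
    ; +-closed  = λ x≈0 y≈0 → trans (+-cong x≈0 y≈0) (+-identityʳ 0#)
    ; +-cancelʳ = λ {x} x+y≈0 y≈0 → trans (sym (+-identityʳ x)) (trans (+-congˡ (sym y≈0)) x+y≈0)
    }

  ∈⟨⟩-isAdditivelyClosed : ∀ {B} {g : Vector Carrier B} → IsAdditivelyClosed (_∈⟨ g ⟩)
  ∈⟨⟩-isAdditivelyClosed = record { resp = ∈⟨⟩-resp ; +-closed = ∈⟨⟩-+ ; +-cancelʳ = ∈⟨⟩-cancelʳ }

  ¬¬≈0-absorb : ∀ {x a s} → ¬ ¬ x ≈ 0# → x ≈ a * (x * x) + s → ∃ λ w → x ≈ w * s
  ¬¬≈0-absorb {x} {a} {s} ¬¬x≈0 x≈ax²+s = w , (begin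
    x          ≈⟨ cancel x ⟨
    x * u * w  ≈⟨ *-congʳ (trans (*-comm x u) u*x≈s) ⟩
    s * w      ≈⟨ *-comm s w ⟩
    w * s      ∎)
    where
    u : Carrier
    u = 1# - a * x

    u≉0 : ¬ u ≈ 0#
    u≉0 u≈0 = ¬¬x≈0 λ x≈0 → 1≉0 (begin
      1#       ≈⟨ +-identityʳ 1# ⟨
      1# + 0#  ≈⟨ +-congˡ ε⁻¹≈ε ⟨
      1# - 0#  ≈⟨ +-congˡ (-‿cong (trans (*-congˡ x≈0) (zeroʳ a))) ⟨
      u        ≈⟨ u≈0 ⟩
      0#       ∎)

    u*x≈s : u * x ≈ s
    u*x≈s = begin
      (1# - a * x) * x               ≈⟨ [y-z]x≈yx-zx x 1# (a * x) ⟩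
      1# * x - a * x * x             ≈⟨ +-cong (*-identityˡ x) (-‿cong (*-assoc a x x)) ⟩
      x - a * (x * x)                ≈⟨ +-congʳ x≈ax²+s ⟩
      a * (x * x) + s - a * (x * x)  ≈⟨ xyx⁻¹≈y (a * (x * x)) s ⟩
      s                              ∎

    w : Carrier
    w = proj₁ (≉0⇒invertibleʳ u≉0)

    cancel : ∀ y → y * u * w ≈ y
    cancel = proj₂ (≉0⇒invertibleʳ u≉0)

  squares : ∀ {B} → Vector Carrier B → Vector Carrier B
  squares v j = v j * v j

  -- Nakayama-type argument: v₀ = a₀ v₀² + s with v₀ ¬¬-zero gives v₀ ∈ (s), so v₀ can be
  -- eliminated from the generators and the family shrinks.
  ¬¬≈0∧∈⟨squares⟩⇒≈0 : ∀ {B} (v : Vector Carrier B) → (∀ j → ¬ ¬ v j ≈ 0#) →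
                       (∀ j → v j ∈⟨ squares v ⟩) → ∀ j → v j ≈ 0#
  ¬¬≈0∧∈⟨squares⟩⇒≈0 {suc B} v ¬¬v≈0 v∈ = λ { zero → v₀≈0 ; (suc j) → tail≈0 j }
    where
    v₀∈ : head v ∈⟨ squares (tail v) ⟩
    v₀∈ with v∈ zero
    ... | a , v₀≈ with ¬¬≈0-absorb (¬¬v≈0 zero) v₀≈
    ...   | w , v₀≈w*s = ∈⟨⟩-resp (sym v₀≈w*s) (∈⟨⟩-*ˡ w (tail a , refl))

    tail≈0 : ∀ j → tail v j ≈ 0#
    tail≈0 = ¬¬≈0∧∈⟨squares⟩⇒≈0 (tail v) (¬¬v≈0 ∘ suc)
      (λ j → ∈⟨⟩-eliminate-head {g = squares v} (∈⟨⟩-*ˡ (head v) v₀∈) (v∈ (suc j)))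

    v₀≈0 : head v ≈ 0#
    v₀≈0 = ∈⟨⟩-null (λ j → trans (*-congʳ (tail≈0 j)) (zeroˡ _)) v₀∈

module TwistedPolynomials {c ℓ} (K : AField c ℓ) where
  open AField K
    using (R; isField; Carrier; setoid; _≈_; _*_; 0#; refl; sym; trans; reflexive;
           *-congˡ; *-congʳ; *-identityʳ; zeroˡ; zeroʳ; p; prime; e≥1; q)
  open FieldProperties R isField
  open import Data.Nat using (_+_; _<_; _≤_; _^_; z<s; _<?_; >-nonZero; nonTrivial⇒n>1)
  open import Data.Nat.Properties
    using (≤-refl; ≤-trans; <-trans; <⇒≤; <⇒≱; ≮⇒≥; <-cmp; n<1+n; m≤m+n; m<m+n; m≤n⇒m<n∨m≡n;
           +-comm; +-suc; +-identityʳ; +-cancelˡ-≡; +-monoˡ-<; +-monoʳ-<; ^-monoʳ-<; m^n>0)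
  open import Data.Nat.Primality using (prime⇒nonTrivial)
  open import Relation.Binary.Reasoning.Setoid setoid

  1<q : 1 < q
  1<q = ^-monoʳ-< p (nonTrivial⇒n>1 p {{prime⇒nonTrivial prime}}) e≥1

  frob-zero : ∀ i {x} → x ≈ 0# → frob K i x ≈ 0#
  frob-zero i x≈0 =
    trans (pow-congˡ (q ^ i) x≈0) (pow-zero (m^n>0 q {{>-nonZero (<-trans z<s 1<q)}} i))

  frob-≉0 : ∀ i {x} → ¬ x ≈ 0# → ¬ frob K i x ≈ 0#
  frob-≉0 i = pow-≉0 (q ^ i)

  frob₀ : ∀ x → frob K 0 x ≈ x
  frob₀ = *-identityʳ

  term : Seq K → Seq K → ℕ → ℕ → Carrier
  term f g i j = f i * frob K i (g j)

  term≈0ˡ : ∀ f g {i} j → f i ≈ 0# → term f g i j ≈ 0#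
  term≈0ˡ f g j fᵢ≈0 = trans (*-congʳ fᵢ≈0) (zeroˡ _)

  term≈0ʳ : ∀ f g i {j} → g j ≈ 0# → term f g i j ≈ 0#
  term≈0ʳ f g i gⱼ≈0 = trans (*-congˡ (frob-zero i gⱼ≈0)) (zeroʳ (f i))

  module _ {p} {Q : Carrier → Set p} (Q-closed : IsAdditivelyClosed Q) (f g : Seq K) where
    open IsAdditivelyClosed Q-closed

    convAux-closed : ∀ i m → (∀ i' j → i' + j ≡ i + m → i ≤ i' → Q (term f g i' j)) →
                     Q (convAux K f g i m)
    convAux-closed i zero    Q-terms = Q-terms i zero ≡.refl ≤-refl
    convAux-closed i (suc m) Q-terms = +-closed (Q-terms i (suc m) ≡.refl ≤-refl)
      (convAux-closed (suc i) m λ i' j e i<i' → Q-terms i' j (≡.trans e (≡.sym (+-suc i m))) (<⇒≤ i<i'))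

    convAux-term : ∀ i m {i₀ j₀} → i ≤ i₀ → i₀ + j₀ ≡ i + m →
                   (∀ i' j → i' + j ≡ i + m → i ≤ i' → i' ≢ i₀ → Q (term f g i' j)) →
                   Q (convAux K f g i m) → Q (term f g i₀ j₀)
    convAux-term i m i≤i₀ e Q-others Q-sum with m≤n⇒m<n∨m≡n i≤i₀
    convAux-term i zero    {j₀ = j₀} _ e Q-others Q-sum | inj₂ ≡.refl
      with ≡.refl ← +-cancelˡ-≡ i j₀ zero e = Q-sum
    convAux-term i (suc m) {j₀ = j₀} _ e Q-others Q-sum | inj₂ ≡.refl
      with ≡.refl ← +-cancelˡ-≡ i j₀ (suc m) e =
      +-cancelʳ Q-sum (convAux-closed (suc i) m λ i' j e' i<i' →
        Q-others i' j (≡.trans e' (≡.sym (+-suc i m))) (<⇒≤ i<i') (λ { ≡.refl → <⇒≱ i<i' ≤-refl }))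
    convAux-term i zero    {i₀} {j₀} _ e Q-others Q-sum | inj₁ i<i₀ =
      ⊥-elim (<⇒≱ i<i₀ (≡.subst (i₀ ≤_) (≡.trans e (+-identityʳ i)) (m≤m+n i₀ j₀)))
    convAux-term i (suc m) _ e Q-others Q-sum | inj₁ i<i₀ =
      convAux-term (suc i) m i<i₀ (≡.trans e (+-suc i m))
        (λ i' j e' i<i' → Q-others i' j (≡.trans e' (≡.sym (+-suc i m))) (<⇒≤ i<i'))
        (+-cancelˡ Q-sum (Q-others i (suc m) ≡.refl ≤-refl (λ { ≡.refl → <⇒≱ i<i₀ ≤-refl })))

    mulSeq-closed : ∀ n → (∀ i j → i + j ≡ n → Q (term f g i j)) → Q (mulSeq K f g n)
    mulSeq-closed n Q-terms = convAux-closed 0 n λ i j e _ → Q-terms i j e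

    mulSeq-term : ∀ n {i₀ j₀} → i₀ + j₀ ≡ n → (∀ i j → i + j ≡ n → i ≢ i₀ → Q (term f g i j)) →
                  Q (mulSeq K f g n) → Q (term f g i₀ j₀)
    mulSeq-term n e Q-others = convAux-term 0 n ℕ.z≤n e λ i j e' _ → Q-others i j e'

  VanishesAbove : Seq K → ℕ → Set ℓ
  VanishesAbove f d = ∀ k → d < k → f k ≈ 0#

  mulSeq-vanishesAbove : ∀ {f g m d} → VanishesAbove f m → VanishesAbove g d →
                         VanishesAbove (mulSeq K f g) (m + d)
  mulSeq-vanishesAbove {f} {g} f↑ g↑ n m+d<n =
    mulSeq-closed ≈0-isAdditivelyClosed f g n λ i j i+j≡n →
      case +-<-split (≡.subst (_ <_) (≡.sym i+j≡n) m+d<n) of λ where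
        (inj₁ m<i) → term≈0ˡ f g j (f↑ i m<i)
        (inj₂ d<j) → term≈0ʳ f g i (g↑ j d<j)

  mulSeq-leading≈0 : ∀ {f g m d} → VanishesAbove f m → VanishesAbove g d →
                     mulSeq K f g (m + d) ≈ 0# → term f g m d ≈ 0#
  mulSeq-leading≈0 {f} {g} {m} {d} f↑ g↑ =
    mulSeq-term ≈0-isAdditivelyClosed f g (m + d) ≡.refl λ i j i+j≡m+d i≢m →
      case +-≡-split i+j≡m+d i≢m of λ where
        (inj₁ m<i) → term≈0ˡ f g j (f↑ i m<i)
        (inj₂ d<j) → term≈0ʳ f g i (g↑ j d<j)

  Intertwines : Tw K → Tw K → Tw K → Set ℓ
  Intertwines φ ψ f = ∀ n → mulSeq K (coeff f) (coeff φ) n ≈ mulSeq K (coeff ψ) (coeff f) n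

  module DrinfeldIntertwiner {φ ψ : Drinfeld K} (rk≢ : rank φ ≢ rank ψ)
                             (f : Tw K) (f∘φ≈ψ∘f : Intertwines (ψt φ) (ψt ψ) f) where
    F a b : Seq K
    F = coeff f
    a = coeff (ψt φ)
    b = coeff (ψt ψ)

    r s : ℕ
    r = rank φ
    s = rank ψ

    leading-¬¬≈0 : ∀ {m} → VanishesAbove F m → ¬ ¬ F m ≈ 0#
    leading-¬¬≈0 {m} F↑ Fₘ≉0 with <-cmp r s
    ... | tri< r<s _ _ = *-≉0 (lead ψ) (frob-≉0 s Fₘ≉0) (mulSeq-leading≈0 (above ψ) F↑ (begin
      mulSeq K b F (s + m)  ≈⟨ f∘φ≈ψ∘f (s + m) ⟨
      mulSeq K F a (s + m)  ≈⟨ mulSeq-vanishesAbove F↑ (above φ) (s + m) m+r<s+m ⟩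
      0#                    ∎))
      where
      m+r<s+m : m + r < s + m
      m+r<s+m = ≡.subst (_< s + m) (+-comm r m) (+-monoˡ-< m r<s)
    ... | tri≈ _ r≡s _ = rk≢ r≡s
    ... | tri> _ _ s<r = *-≉0 Fₘ≉0 (frob-≉0 m (lead φ)) (mulSeq-leading≈0 F↑ (above φ) (begin
      mulSeq K F a (m + r)  ≈⟨ f∘φ≈ψ∘f (m + r) ⟩
      mulSeq K b F (m + r)  ≈⟨ mulSeq-vanishesAbove (above ψ) F↑ (m + r) s+m<m+r ⟩
      0#                    ∎))
      where
      s+m<m+r : s + m < m + r
      s+m<m+r = ≡.subst (_< m + r) (+-comm m s) (+-monoʳ-< m s<r)

    vanishesAbove-bound : ∀ {m} → bound f ≤ m → VanishesAbove F m
    vanishesAbove-bound B≤m k m<k = support f k (≤-trans B≤m (<⇒≤ m<k))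

    ¬¬vanishesAbove : ∀ n → ¬ ¬ VanishesAbove F n
    ¬¬vanishesAbove = downwardInduction (λ m → ¬ ¬ VanishesAbove F m) (bound f)
      (λ k B<k ¬F↑ → ¬F↑ (vanishesAbove-bound (<⇒≤ B<k)))
      (λ m ¬¬F↑ ¬F↑ → ¬¬F↑ (suc m) (n<1+n m) λ F↑ →
        leading-¬¬≈0 F↑ λ Fₘ₊₁≈0 → ¬F↑ (lower F↑ Fₘ₊₁≈0))
      where
      lower : ∀ {m} → VanishesAbove F (suc m) → F (suc m) ≈ 0# → VanishesAbove F m
      lower {m} F↑ Fₘ₊₁≈0 k m<k with m≤n⇒m<n∨m≡n m<k
      ... | inj₁ 1+m<k   = F↑ k 1+m<k
      ... | inj₂ ≡.refl = Fₘ₊₁≈0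

    coeff-¬¬≈0 : ∀ n → ¬ ¬ F n ≈ 0#
    coeff-¬¬≈0 n ¬Fₙ≈0 = ¬¬vanishesAbove n λ F↑ → leading-¬¬≈0 F↑ ¬Fₙ≈0

    low : Vector Carrier (bound f)
    low j = F (toℕ j)

    square∈ : ∀ k → F k * F k ∈⟨ squares low ⟩
    square∈ k with k <? bound f
    ... | yes k<B = ∈⟨⟩-resp (reflexive (≡.cong (λ k → F k * F k) (toℕ-fromℕ< k<B)))
                      (generator∈⟨⟩ (fromℕ< k<B))
    ... | no  k≮B = ≈0⇒∈⟨⟩ (trans (*-congʳ (support f k (≮⇒≥ k≮B))) (zeroˡ (F k)))

    coeff∈ : ∀ n → F n ∈⟨ squares low ⟩
    coeff∈ = downwardInduction (λ k → F k ∈⟨ squares low ⟩) (bound f)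
      (λ k B<k → ≈0⇒∈⟨⟩ (vanishesAbove-bound ≤-refl k B<k))
      λ m F↑∈ → ∈⟨⟩-cancel-≉0 (frob-≉0 m (lead φ))
        (mulSeq-term ∈⟨⟩-isAdditivelyClosed F a (m + r) ≡.refl
          (λ i j i+j≡m+r i≢m → case +-≡-split i+j≡m+r i≢m of λ where
            (inj₁ m<i) → ∈⟨⟩-*ʳ _ (F↑∈ i m<i)
            (inj₂ r<j) → ≈0⇒∈⟨⟩ (term≈0ʳ F a i (above φ j r<j)))
          (∈⟨⟩-resp (sym (f∘φ≈ψ∘f (m + r)))
            (mulSeq-closed ∈⟨⟩-isAdditivelyClosed b F (m + r) λ where
              zero j ≡.refl → ∈⟨⟩-*ˡ (b 0) (∈⟨⟩-resp (sym (frob₀ (F j))) (F↑∈ j (m<m+n m (rank≥1 φ))))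
              (suc i) j _   → ∈⟨⟩-*ˡ (b (suc i)) (pow∈⟨⟩ (^-monoʳ-< q 1<q (z<s {i})) (square∈ j)))))

    coeff≈0 : ∀ n → F n ≈ 0#
    coeff≈0 n with n <? bound f
    ... | yes n<B = trans (reflexive (≡.cong F (≡.sym (toℕ-fromℕ< n<B)))) (low≈0 (fromℕ< n<B))
      where
      low≈0 : ∀ j → low j ≈ 0#
      low≈0 = ¬¬≈0∧∈⟨squares⟩⇒≈0 low (coeff-¬¬≈0 ∘ toℕ) (coeff∈ ∘ toℕ)
    ... | no  n≮B = support f n (≮⇒≥ n≮B)

  drinfeld-intertwiner≈0 : ∀ {φ ψ : Drinfeld K} → rank φ ≢ rank ψ →
                           ∀ f → Intertwines (ψt φ) (ψt ψ) f → _≈τ_ K f (zeroTw K)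
  drinfeld-intertwiner≈0 {φ} {ψ} rk≢ f f∘φ≈ψ∘f = DrinfeldIntertwiner.coeff≈0 {φ} {ψ} rk≢ f f∘φ≈ψ∘f

module Matrices {c ℓ} (K : AField c ℓ) where
  open AField K hiding (zero)
  open FieldProperties R isField using (IsAdditivelyClosed; ≈0-isAdditivelyClosed)
  open TwistedPolynomials K using (Intertwines; mulSeq-closed; term≈0ˡ; term≈0ʳ; drinfeld-intertwiner≈0)
  open import Data.Nat as ℕ using (_∸_)
  open import Data.Nat.Properties using (+-monoˡ-<; +-monoʳ-<; ∸-monoʳ-<; <⇒≤)
  open import Data.Fin as Fin using (_<_)
  open import Data.Fin.Properties using (<-cmp; <-irrefl; <-asym; toℕ<n; suc-injective)
  open import Data.Nat.Induction using (<-wellFounded)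
  open import Induction.WellFounded using (module All)
  import Relation.Binary.Construct.On as On
  open import Relation.Binary.Reasoning.Setoid setoid

  sumFin-≈0 : ∀ n (g : Fin n → Seq K) k → (∀ l → g l k ≈ 0#) → sumFin K n g k ≈ 0#
  sumFin-≈0 zero    g k g≈0 = refl
  sumFin-≈0 (suc n) g k g≈0 = +-closed (g≈0 zero) (sumFin-≈0 n (g ∘ suc) k (g≈0 ∘ suc))
    where open IsAdditivelyClosed ≈0-isAdditivelyClosed

  sumFin-single : ∀ n (g : Fin n → Seq K) l₀ k → (∀ l → l ≢ l₀ → g l k ≈ 0#) → sumFin K n g k ≈ g l₀ k
  sumFin-single (suc n) g zero k g≈0 =
    trans (+-congˡ (sumFin-≈0 n (g ∘ suc) k λ l → g≈0 (suc l) λ ())) (+-identityʳ (g zero k))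
  sumFin-single (suc n) g (suc l₀) k g≈0 =
    trans (+-cong (g≈0 zero λ ())
                  (sumFin-single n (g ∘ suc) l₀ k λ l l≢l₀ → g≈0 (suc l) (l≢l₀ ∘ suc-injective)))
          (+-identityˡ (g (suc l₀) k))

  mulSeq-zeroˡ : ∀ {f} g → (∀ i → f i ≈ 0#) → ∀ n → mulSeq K f g n ≈ 0#
  mulSeq-zeroˡ {f} g f≈0 n = mulSeq-closed ≈0-isAdditivelyClosed f g n λ i j _ → term≈0ˡ f g j (f≈0 i)

  mulSeq-zeroʳ : ∀ f {g} → (∀ j → g j ≈ 0#) → ∀ n → mulSeq K f g n ≈ 0#
  mulSeq-zeroʳ f {g} g≈0 n = mulSeq-closed ≈0-isAdditivelyClosed f g n λ i j _ → term≈0ʳ f g i (g≈0 j)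

  UpperTriangular : ∀ {n} → Mat K n n → Set ℓ
  UpperTriangular Φ = ∀ {l j} → j < l → ∀ k → coeff (Φ l j) k ≈ 0#

  upperTriangular-homZero : ∀ {d e} {Φ : Mat K d d} {Ψ : Mat K e e} →
    UpperTriangular Φ → UpperTriangular Ψ →
    (∀ i j f → Intertwines (Φ j j) (Ψ i i) f → _≈τ_ K f (zeroTw K)) → HomZero K Φ Ψ
  upperTriangular-homZero {d} {e} {Φ} {Ψ} Φ-upper Ψ-upper diagonal F F-hom i j =
    All.wfRec (On.wellFounded μ <-wellFounded) ℓ Vanishes step (i , j)
    where
    μ : Fin e × Fin d → ℕ
    μ (i , j) = toℕ j ℕ.+ (e ∸ toℕ i)

    Vanishes : Fin e × Fin d → Set ℓ
    Vanishes (i , j) = _≈τ_ K (F i j) (zeroTw K)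

    step : ∀ x → (∀ {y} → μ y ℕ.< μ x → Vanishes y) → Vanishes x
    step (i , j) IH = diagonal i j (F i j) λ n → begin
      mulSeq K (coeff (F i j)) (coeff (Φ j j)) n  ≈⟨ sumFin-single d _ j n (left n) ⟨
      matMul K F Φ i j n                          ≈⟨ F-hom i j n ⟩
      matMul K Ψ F i j n                          ≈⟨ sumFin-single e _ i n (below n) ⟩
      mulSeq K (coeff (Ψ i i)) (coeff (F i j)) n  ∎
      where
      left : ∀ n l → l ≢ j → mulSeq K (coeff (F i l)) (coeff (Φ l j)) n ≈ 0#
      left n l l≢j with <-cmp l j
      ... | tri< l<j _ _ = mulSeq-zeroˡ _ (IH (+-monoˡ-< (e ∸ toℕ i) l<j)) n
      ... | tri≈ _ l≡j _ = ⊥-elim (l≢j l≡j)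
      ... | tri> _ _ j<l = mulSeq-zeroʳ _ (Φ-upper j<l) n

      below : ∀ n l → l ≢ i → mulSeq K (coeff (Ψ i l)) (coeff (F l j)) n ≈ 0#
      below n l l≢i with <-cmp l i
      ... | tri< l<i _ _ = mulSeq-zeroˡ _ (Ψ-upper l<i) n
      ... | tri≈ _ l≡i _ = ⊥-elim (l≢i l≡i)
      ... | tri> _ _ i<l = mulSeq-zeroʳ _ (IH (+-monoʳ-< (toℕ j) (∸-monoʳ-< i<l (<⇒≤ (toℕ<n l))))) n

  Υt-diagonal : ∀ {n} (T : Triangular K n) j → Υt K T j j ≡ ψt (ψ T j)
  Υt-diagonal T j with j Fin.≟ j
  ... | yes _   = ≡.refl
  ... | no j≢j = ⊥-elim (j≢j ≡.refl)

  Υt-upperTriangular : ∀ {n} (T : Triangular K n) → UpperTriangular (Υt K T)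
  Υt-upperTriangular T {l} {j} j<l k with l Fin.≟ j
  ... | yes ≡.refl = ⊥-elim (<-irrefl ≡.refl j<l)
  ... | no _ with l Fin.<? j
  ...   | yes l<j = ⊥-elim (<-asym l<j j<l)
  ...   | no _    = refl

  triangular-homZero : ∀ {n n̂} (Υ : Triangular K n) (Υ̂ : Triangular K n̂) →
    (∀ l j → rank (ψ Υ l) ≢ rank (ψ Υ̂ j)) → HomZero K (Υt K Υ) (Υt K Υ̂)
  triangular-homZero Υ Υ̂ rk≢ =
    upperTriangular-homZero {Φ = Υt K Υ} {Ψ = Υt K Υ̂}
      (Υt-upperTriangular Υ) (Υt-upperTriangular Υ̂) λ i j f →
      drinfeld-intertwiner≈0 {ψ Υ j} {ψ Υ̂ i} (rk≢ j i) f ∘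
        ≡.subst₂ (λ φ ψ → Intertwines φ ψ f) (Υt-diagonal Υ j) (Υt-diagonal Υ̂ i)

proposition5p1 : ∀ {c ℓ} (K : AField c ℓ) {n n̂ : ℕ}
    (Υ : Triangular K n) (Υ̂ : Triangular K n̂) →
    (∀ (l : Fin n) (j : Fin n̂) → rank (ψ Υ l) ≢ rank (ψ Υ̂ j)) →
    HomZero K (Υt K Υ) (Υt K Υ̂) × HomZero K (Υt K Υ̂) (Υt K Υ)
proposition5p1 K Υ Υ̂ rk≢ =
  triangular-homZero Υ Υ̂ rk≢ , triangular-homZero Υ̂ Υ (λ l j → rk≢ j l ∘ ≡.sym)
  where open Matrices K
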